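{- Let $G$ be a simple connected graph of order $n\geq 3$, and let $S\subseteq V(G)$. If $S$ is a vertex cover of $G$ and $\partial_G(S)=\partial(G)$, then $S$ is a differential set of $R(G)$.
   Context: $R(G)$ is the graph obtained from $G$ by adding, for each edge $e=xy\in E(G)$, a new vertex $v_e$ adjacent exactly to $x$ and $y$; thus $V(G)\subseteq V(R(G))$. For a graph $H$ and $S\subseteq V(H)$, $B_H(S)$ is the set of vertices not in $S$ adjacent to some vertex of $S$, $\partial_H(S)=|B_H(S)|-|S|$, $\partial(H)=\max_{S\subseteq V(H)}\partial_H(S)$, and $S$ is a differential set of $H$ if $\partial_H(S)=\partial(H)$. A vertex cover of $G$ is a set of vertices containing at least one end vertex of every edge. -}

module Defs where

open import Data.Nat using (ℕ; zero; suc; _<_; _≥_)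
open import Data.Nat.Properties using (_<?_)
open import Data.Bool using (Bool; true; false; _∧_; _∨_; not; T)
open import Data.Fin using (Fin; toℕ)
open import Data.Vec using (Vec; []; _∷_; lookup; tabulate)
open import Data.List using (List; []; _∷_; length; filter; map; concatMap; allFin; foldr; sum)
open import Data.List.Relation.Unary.Any using (Any)
open import Data.Integer using (ℤ; _-_; +_; _⊔_)
open import Data.Product using (Σ; _×_; _,_; proj₁; proj₂)
open import Relation.Binary.PropositionalEquality using (_≡_; refl)
open import Relation.Nullary using (¬_)
open import Relation.Nullary.Decidable using (⌊_⌋)

record Graph : Set where
  field
    order : ℕ
    adj   : Fin order → Fin order → Bool
    sym   : ∀ i j → adj i j ≡ adj j i
    irr   : ∀ i → adj i i ≡ false
open Graph public

VSet : ℕ → Set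
VSet n = Vec Bool n

_∈ₛ_ : ∀ {n} → Fin n → VSet n → Bool
i ∈ₛ S = lookup S i

count : ∀ {n} → (Fin n → Bool) → ℕ
count {n} p = length (filter (λ i → T? (p i)) (allFin n))
  where
  open import Data.Bool.Properties using () renaming (T? to T?)

card : ∀ {n} → VSet n → ℕ
card S = count (λ i → i ∈ₛ S)

anyFin : ∀ {n} → (Fin n → Bool) → Bool
anyFin {n} p = foldr (λ i b → p i ∨ b) false (allFin n)

inBoundary : (H : Graph) → VSet (order H) → Fin (order H) → Bool
inBoundary H S v = not (v ∈ₛ S) ∧ anyFin (λ u → (u ∈ₛ S) ∧ adj H u v)

∂ₛ : (H : Graph) → VSet (order H) → ℤ
∂ₛ H S = + count (inBoundary H S) - + card S

allSubsets : (n : ℕ) → List (VSet n)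
allSubsets zero = [] ∷ []
allSubsets (suc n) = concatMap (λ S → (false ∷ S) ∷ (true ∷ S) ∷ []) (allSubsets n)

-- ∂(H) = max over S ⊆ V(H) of ∂_H(S)   (∂_H(∅) = 0, so 0 is a valid seed)
∂G : Graph → ℤ
∂G H = foldr (λ S m → ∂ₛ H S ⊔ m) (∂ₛ H (tabulate (λ _ → false))) (allSubsets (order H))

IsDifferentialSet : (H : Graph) → VSet (order H) → Set
IsDifferentialSet H S = ∂ₛ H S ≡ ∂G H

IsVertexCover : (G : Graph) → VSet (order G) → Set
IsVertexCover G S = ∀ x y → adj G x y ≡ true → (x ∈ₛ S) ∨ (y ∈ₛ S) ≡ true

data Walk (G : Graph) : Fin (order G) → Fin (order G) → Set where
  here : ∀ {x} → Walk G x x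
  step : ∀ {x y z} → adj G x y ≡ true → Walk G y z → Walk G x z

Connected : Graph → Set
Connected G = ∀ x y → Walk G x y

edgeList : (G : Graph) → List (Fin (order G) × Fin (order G))
edgeList G = concatMap (λ x → map (λ y → x , y)
               (filter (λ y → T? (adj G x y ∧ ⌊ toℕ x <? toℕ y ⌋)) (allFin (order G))))
               (allFin (order G))
  where open import Data.Bool.Properties using () renaming (T? to T?)

-- R(G): vertices are Fin n ⊎ Fin m (m = |E(G)|), coded as Fin (n + m)
-- via Data.Fin's _↑ˡ_ / _↑ʳ_ ; original vertex x is x ↑ˡ m.
open import Data.Fin using (_↑ˡ_; _↑ʳ_; splitAt)
open import Data.Sum using (inj₁; inj₂)
open import Data.List using () renaming (lookup to lookupL)
open import Data.Fin using (_≟_)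
open import Data.Vec using (_++_; replicate)

private
  eqB : ∀ {n} → Fin n → Fin n → Bool
  eqB a b = ⌊ a ≟ b ⌋

  endOf : (G : Graph) → Fin (length (edgeList G)) → Fin (order G) → Bool
  endOf G e x = eqB x (proj₁ (lookupL (edgeList G) e)) ∨ eqB x (proj₂ (lookupL (edgeList G) e))

RAdj : (G : Graph) → Fin (order G Data.Nat.+ length (edgeList G))
                   → Fin (order G Data.Nat.+ length (edgeList G)) → Bool
RAdj G a b = go (splitAt (order G) a) (splitAt (order G) b)
  where
  go : _ → _ → Bool
  go (inj₁ x) (inj₁ y) = adj G x y
  go (inj₁ x) (inj₂ e) = endOf G e x
  go (inj₂ e) (inj₁ y) = endOf G e y
  go (inj₂ e) (inj₂ f) = false

private
  RAdj-sym : (G : Graph) → ∀ a b → RAdj G a b ≡ RAdj G b a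
  RAdj-sym G a b with splitAt (order G) a | splitAt (order G) b
  ... | inj₁ x | inj₁ y = Graph.sym G x y
  ... | inj₁ x | inj₂ e = refl
  ... | inj₂ e | inj₁ y = refl
  ... | inj₂ e | inj₂ f = refl

  RAdj-irr : (G : Graph) → ∀ a → RAdj G a a ≡ false
  RAdj-irr G a with splitAt (order G) a
  ... | inj₁ x = Graph.irr G x
  ... | inj₂ e = refl

R : Graph → Graph
R G = record { order = order G Data.Nat.+ length (edgeList G)
             ; adj = RAdj G ; sym = RAdj-sym G ; irr = RAdj-irr G }

embed : (G : Graph) → VSet (order G) → VSet (order (R G))
embed G S = S ++ replicate (length (edgeList G)) false

-- Let m = |E(G)|. Take T ⊆ V(R(G)) with T₁ = T ∩ V(G) containing q of the new
-- vertices v_e. A vertex of G in B(T) lies in B_G(T₁) or is an end of one of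
-- those q edges (at most 2q vertices), and at most m − q vertices v_e lie in
-- B(T); hence ∂_{R(G)}(T) ≤ ∂_G(T₁) + m ≤ ∂(G) + m. Conversely, if S is a
-- vertex cover then every v_e lies in B(S) and B_G(S) ⊆ B(S), so
-- ∂_{R(G)}(S) ≥ ∂_G(S) + m = ∂(G) + m.
module Submission where

open import Defs hiding (sym)
open import Data.Nat using (ℕ; zero; suc; _+_; _*_; _≤_; _≥_; z≤n; s≤s)
open import Data.Nat.Properties as ℕ
  using (+-*-semiring; +-mono-≤; +-monoˡ-≤; ≤-trans; ≤-reflexive; m≤m+n; m≤n+m; module ≤-Reasoning)
import Data.Nat.Tactic.RingSolver as ℕ-Solver
open import Data.Bool using (Bool; true; false; _∧_; _∨_; not; T)
open import Data.Bool.Properties using (T?; ∨-zeroʳ)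
open import Data.Fin using (Fin; zero; suc; toℕ; _↑ˡ_; _↑ʳ_; splitAt; _≟_)
open import Data.Fin.Properties using (splitAt-↑ˡ; splitAt-↑ʳ; splitAt⁻¹-↑ˡ; splitAt⁻¹-↑ʳ)
open import Data.Vec using ([]; _∷_; lookup; tabulate; replicate)
open import Data.Vec.Properties using (lookup-++ˡ; lookup-++ʳ; lookup-replicate; lookup∘tabulate)
open import Data.Vec.Functional using (Vector)
open import Data.List as List using (List; length; filter; allFin; foldr)
open import Data.List.Membership.Propositional using (_∈_)
open import Data.List.Membership.Propositional.Properties
  using (∈-lookup; ∈-concatMap⁺; ∈-concatMap⁻; ∈-map⁻; ∈-filter⁻)
open import Data.List.Relation.Unary.Any as Any using (here; there)
open import Data.Integer as ℤ using (ℤ; +_; -_; _-_; _⊔_; +≤+)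
open import Data.Integer.Properties as ℤ using (i≤i⊔j; i≤j⇒i≤k⊔j; ⊔-lub; pos-+)
open import Data.Integer.Tactic.RingSolver as ℤ-Solver using ()
open import Data.Product using (_×_; _,_; proj₁; proj₂; ∃)
open import Data.Sum using (_⊎_; inj₁; inj₂)
open import Function using (_∘_; id)
open import Relation.Binary.PropositionalEquality
open import Relation.Nullary.Decidable using (yes; no; ⌊_⌋; isYes≗does; dec-true)
open import Algebra.Properties.Semiring.Sum +-*-semiring
  using (sum; sum-cong-≗; sum-replicate-zero; ∑-distrib-+; ∑-comm; *-distribˡ-sum; *-distribʳ-sum)

𝟙 : Bool → ℕ
𝟙 true  = 1
𝟙 false = 0

𝟙≤1 : ∀ b → 𝟙 b ≤ 1
𝟙≤1 true  = s≤s z≤n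
𝟙≤1 false = z≤n

𝟙-mono : ∀ {a b} → (a ≡ true → b ≡ true) → 𝟙 a ≤ 𝟙 b
𝟙-mono {false} _ = z≤n
𝟙-mono {true}  h rewrite h refl = s≤s z≤n

∧-true⁻ : ∀ {a b} → a ∧ b ≡ true → a ≡ true × b ≡ true
∧-true⁻ {true} {true} _ = refl , refl

T-∧⇒≡trueˡ : ∀ {a b} → T (a ∧ b) → a ≡ true
T-∧⇒≡trueˡ {true} _ = refl

⌊≟-refl⌋ : ∀ {k} (x : Fin k) → ⌊ x ≟ x ⌋ ≡ true
⌊≟-refl⌋ x = trans (isYes≗does (x ≟ x)) (dec-true (x ≟ x) refl)

sum-mono-≤ : ∀ {n} {f g : Vector ℕ n} → (∀ i → f i ≤ g i) → sum f ≤ sum g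
sum-mono-≤ {zero}  f≤g = z≤n
sum-mono-≤ {suc n} f≤g = +-mono-≤ (f≤g zero) (sum-mono-≤ (f≤g ∘ suc))

sum-splitAt : ∀ m n (f : Vector ℕ (m + n)) → sum f ≡ sum (f ∘ (_↑ˡ n)) + sum (f ∘ (m ↑ʳ_))
sum-splitAt zero    n f = refl
sum-splitAt (suc m) n f = trans (cong (λ s → f zero + s) (sum-splitAt m n (f ∘ suc))) (sym (ℕ.+-assoc (f zero) _ _))

term≤sum : ∀ {n} (f : Vector ℕ n) i → f i ≤ sum f
term≤sum f zero    = m≤m+n _ _
term≤sum f (suc i) = ≤-trans (term≤sum (f ∘ suc) i) (m≤n+m _ _)

sum-ones : ∀ n → sum {n} (λ _ → 1) ≡ n
sum-ones zero    = refl
sum-ones (suc n) = cong suc (sum-ones n)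

sum-𝟙-≟ : ∀ {n} (a : Fin n) → sum (λ x → 𝟙 ⌊ x ≟ a ⌋) ≡ 1
sum-𝟙-≟ {suc n} zero    = cong suc (trans (sum-cong-≗ {n} λ _ → refl) (sum-replicate-zero n))
sum-𝟙-≟ {suc n} (suc a) = trans (sum-cong-≗ {n} 𝟙-≟-suc) (sum-𝟙-≟ a)
  where
  𝟙-≟-suc : ∀ x → 𝟙 ⌊ suc x ≟ suc a ⌋ ≡ 𝟙 ⌊ x ≟ a ⌋
  𝟙-≟-suc x with x ≟ a
  ... | yes _ = refl
  ... | no _  = refl

count-tabulate : ∀ {n k} (p : Fin k → Bool) (f : Fin n → Fin k) →
                 length (filter (T? ∘ p) (List.tabulate f)) ≡ sum (𝟙 ∘ p ∘ f)
count-tabulate {zero}  p f = refl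
count-tabulate {suc n} p f with p (f zero)
... | true  = cong suc (count-tabulate p (f ∘ suc))
... | false = count-tabulate p (f ∘ suc)

count≡sum : ∀ {n} (p : Fin n → Bool) → count p ≡ sum (𝟙 ∘ p)
count≡sum p = count-tabulate p id

anyFin-tabulate⁺ : ∀ {n k} (p : Fin k → Bool) (f : Fin n → Fin k) i →
                   p (f i) ≡ true → foldr (λ j b → p j ∨ b) false (List.tabulate f) ≡ true
anyFin-tabulate⁺ p f zero    pfi rewrite pfi = refl
anyFin-tabulate⁺ p f (suc i) pfi rewrite anyFin-tabulate⁺ p (f ∘ suc) i pfi = ∨-zeroʳ (p (f zero))

anyFin⁺ : ∀ {n} (p : Fin n → Bool) i → p i ≡ true → anyFin p ≡ true
anyFin⁺ p = anyFin-tabulate⁺ p id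

anyFin-tabulate⁻ : ∀ {n k} (p : Fin k → Bool) (f : Fin n → Fin k) →
                   foldr (λ j b → p j ∨ b) false (List.tabulate f) ≡ true → ∃ λ i → p (f i) ≡ true
anyFin-tabulate⁻ {suc n} p f any with p (f zero) in pf0
... | true  = zero , pf0
... | false = let i , pfi = anyFin-tabulate⁻ p (f ∘ suc) any in suc i , pfi

anyFin⁻ : ∀ {n} (p : Fin n → Bool) → anyFin p ≡ true → ∃ λ i → p i ≡ true
anyFin⁻ p = anyFin-tabulate⁻ p id

foldr-⊔-upper : ∀ {A : Set} (f : A → ℤ) z {x} {xs : List A} → x ∈ xs → f x ℤ.≤ foldr (λ y r → f y ⊔ r) z xs
foldr-⊔-upper f z (here refl)       = i≤i⊔j (f _) _
foldr-⊔-upper f z {xs = y List.∷ _} (there x∈xs) = i≤j⇒i≤k⊔j (f y) (foldr-⊔-upper f z x∈xs)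

foldr-⊔-lub : ∀ {A : Set} (f : A → ℤ) {z b} (xs : List A) → z ℤ.≤ b → (∀ x → f x ℤ.≤ b) →
              foldr (λ y r → f y ⊔ r) z xs ℤ.≤ b
foldr-⊔-lub f List.[]        z≤b f≤b = z≤b
foldr-⊔-lub f (y List.∷ ys) z≤b f≤b = ⊔-lub (f≤b y) (foldr-⊔-lub f ys z≤b f≤b)

∈-allSubsets : ∀ n (S : VSet n) → S ∈ allSubsets n
∈-allSubsets zero    []      = here refl
∈-allSubsets (suc n) (b ∷ S) = ∈-concatMap⁺ extensions (Any.map (λ { refl → b∷S∈extensions b }) (∈-allSubsets n S))
  where
  extensions : VSet n → List (VSet (suc n))
  extensions S = (false ∷ S) List.∷ (true ∷ S) List.∷ List.[]
  b∷S∈extensions : ∀ b → (b ∷ S) ∈ extensions S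
  b∷S∈extensions false = here refl
  b∷S∈extensions true  = there (here refl)

∂ₛ≤∂G : ∀ H S → ∂ₛ H S ℤ.≤ ∂G H
∂ₛ≤∂G H S = foldr-⊔-upper (∂ₛ H) _ (∈-allSubsets (order H) S)

∂G-lub : ∀ H {b} → (∀ T → ∂ₛ H T ℤ.≤ b) → ∂G H ℤ.≤ b
∂G-lub H ∂≤b = foldr-⊔-lub (∂ₛ H) (allSubsets (order H)) (∂≤b (tabulate λ _ → false)) ∂≤b

m-n≤o-p : ∀ a b c d → a + d ≤ c + b → + a - + b ℤ.≤ + c - + d
m-n≤o-p a b c d a+d≤c+b = subst₂ ℤ._≤_ (cancel (+ a) (+ b) (+ d)) (cancel′ (+ c) (+ b) (+ d))
  (ℤ.+-monoˡ-≤ (- (+ b ℤ.+ + d)) (subst₂ ℤ._≤_ (pos-+ a d) (pos-+ c b) (+≤+ a+d≤c+b)))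
  where
  cancel : ∀ x y w → (x ℤ.+ w) ℤ.+ - (y ℤ.+ w) ≡ x - y
  cancel = ℤ-Solver.solve-∀
  cancel′ : ∀ z y w → (z ℤ.+ y) ℤ.+ - (y ℤ.+ w) ≡ z - w
  cancel′ = ℤ-Solver.solve-∀

m-n+k≡m+k-n : ∀ a b k → (+ a - + b) ℤ.+ + k ≡ + (a + k) - + b
m-n+k≡m+k-n a b k = trans (reorder (+ a) (+ b) (+ k)) (cong (_- + b) (sym (pos-+ a k)))
  where
  reorder : ∀ x y w → (x - y) ℤ.+ w ≡ (x ℤ.+ w) - y
  reorder = ℤ-Solver.solve-∀

module _ (G : Graph) where
  private
    n = order G
    m = length (edgeList G)

  end₁ end₂ : Fin m → Fin n
  end₁ e = proj₁ (List.lookup (edgeList G) e)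
  end₂ e = proj₂ (List.lookup (edgeList G) e)

  IsEndOf : Fin n → Fin m → Bool
  IsEndOf x e = ⌊ x ≟ end₁ e ⌋ ∨ ⌊ x ≟ end₂ e ⌋

  incidence : Fin n → Fin m → ℕ
  incidence x e = 𝟙 ⌊ x ≟ end₁ e ⌋ + 𝟙 ⌊ x ≟ end₂ e ⌋

  IsEndOf⇒1≤incidence : ∀ x e → IsEndOf x e ≡ true → 1 ≤ incidence x e
  IsEndOf⇒1≤incidence x e _ with ⌊ x ≟ end₁ e ⌋ | ⌊ x ≟ end₂ e ⌋
  ... | true  | _    = s≤s z≤n
  ... | false | true = s≤s z≤n

  sum-incidence : ∀ e → sum (λ x → incidence x e) ≡ 2
  sum-incidence e = trans (∑-distrib-+ {n} _ _) (cong₂ _+_ (sum-𝟙-≟ (end₁ e)) (sum-𝟙-≟ (end₂ e)))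

  -- These reproduce the inner function of edgeList, so that ∈-concatMap⁻ applies to it.
  IsForwardEdge : Fin n → Fin n → Bool
  IsForwardEdge x y = adj G x y ∧ ⌊ toℕ x ℕ.<? toℕ y ⌋

  edgesFrom : Fin n → List (Fin n × Fin n)
  edgesFrom x = List.map (x ,_) (filter (T? ∘ IsForwardEdge x) (allFin n))

  ∈-edgeList⇒adj : ∀ {x y} → (x , y) ∈ edgeList G → adj G x y ≡ true
  ∈-edgeList⇒adj xy∈ with Any.satisfied (∈-concatMap⁻ edgesFrom {xs = allFin n} xy∈)
  ... | x , xy∈edgesFrom with ∈-map⁻ (x ,_) xy∈edgesFrom
  ... | y , y∈ , refl = T-∧⇒≡trueˡ (proj₂ (∈-filter⁻ (T? ∘ IsForwardEdge x) {xs = allFin n} y∈))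

  end₁-adj-end₂ : ∀ e → adj G (end₁ e) (end₂ e) ≡ true
  end₁-adj-end₂ e = ∈-edgeList⇒adj (∈-lookup e)

  RAdj-↑ˡ-↑ˡ : ∀ x y → RAdj G (x ↑ˡ m) (y ↑ˡ m) ≡ adj G x y
  RAdj-↑ˡ-↑ˡ x y rewrite splitAt-↑ˡ n x m | splitAt-↑ˡ n y m = refl

  RAdj-↑ʳ-↑ˡ : ∀ e y → RAdj G (n ↑ʳ e) (y ↑ˡ m) ≡ IsEndOf y e
  RAdj-↑ʳ-↑ˡ e y rewrite splitAt-↑ʳ n m e | splitAt-↑ˡ n y m = refl

  RAdj-↑ˡ-↑ʳ : ∀ x e → RAdj G (x ↑ˡ m) (n ↑ʳ e) ≡ IsEndOf x e
  RAdj-↑ˡ-↑ʳ x e rewrite splitAt-↑ˡ n x m | splitAt-↑ʳ n m e = refl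

  ↑ˡ⊎↑ʳ : ∀ (u : Fin (n + m)) → (∃ λ x → x ↑ˡ m ≡ u) ⊎ (∃ λ e → n ↑ʳ e ≡ u)
  ↑ˡ⊎↑ʳ u with splitAt n u in eq
  ... | inj₁ x = inj₁ (x , splitAt⁻¹-↑ˡ eq)
  ... | inj₂ e = inj₂ (e , splitAt⁻¹-↑ʳ eq)

  lookup-embed-↑ˡ : ∀ S x → lookup (embed G S) (x ↑ˡ m) ≡ lookup S x
  lookup-embed-↑ˡ S = lookup-++ˡ S (replicate m false)

  lookup-embed-↑ʳ : ∀ S e → lookup (embed G S) (n ↑ʳ e) ≡ false
  lookup-embed-↑ʳ S e = trans (lookup-++ʳ S (replicate m false) e) (lookup-replicate e false)

  card-embed : ∀ S → card (embed G S) ≡ card S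
  card-embed S = begin
    card S′                                          ≡⟨ count≡sum (lookup S′) ⟩
    sum (𝟙 ∘ lookup S′)                              ≡⟨ sum-splitAt n m _ ⟩
    sum (𝟙 ∘ lookup S′ ∘ (_↑ˡ m))
      + sum (𝟙 ∘ lookup S′ ∘ (n ↑ʳ_))                ≡⟨ cong₂ _+_ (sum-cong-≗ {n} (cong 𝟙 ∘ lookup-embed-↑ˡ S)) no-new-vertices ⟩
    sum (𝟙 ∘ lookup S) + 0                           ≡⟨ ℕ.+-identityʳ _ ⟩
    sum (𝟙 ∘ lookup S)                               ≡⟨ count≡sum (lookup S) ⟨
    card S                                           ∎
    where
    open ≡-Reasoning
    S′ = embed G S
    no-new-vertices : sum (𝟙 ∘ lookup S′ ∘ (n ↑ʳ_)) ≡ 0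
    no-new-vertices = trans (sum-cong-≗ {m} (cong 𝟙 ∘ lookup-embed-↑ʳ S)) (sum-replicate-zero m)

  inBoundary-embed : ∀ S x → inBoundary G S x ≡ true → inBoundary (R G) (embed G S) (x ↑ˡ m) ≡ true
  inBoundary-embed S x x∈B with ∧-true⁻ {not (lookup S x)} x∈B
  ... | x∉S , ∃neighbour with anyFin⁻ _ ∃neighbour
  ... | u , u∈S∧adj = cong₂ _∧_ (trans (cong not (lookup-embed-↑ˡ S x)) x∉S)
    (anyFin⁺ _ (u ↑ˡ m) (trans (cong₂ _∧_ (lookup-embed-↑ˡ S u) (RAdj-↑ˡ-↑ˡ u x)) u∈S∧adj))

  vertexCover⇒inBoundary-↑ʳ : ∀ S → IsVertexCover G S → ∀ e → inBoundary (R G) (embed G S) (n ↑ʳ e) ≡ true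
  vertexCover⇒inBoundary-↑ʳ S cover e rewrite lookup-embed-↑ʳ S e
    with lookup S (end₁ e) in end₁∈S | cover (end₁ e) (end₂ e) (end₁-adj-end₂ e)
  ... | true  | _       = anyFin⁺ _ (end₁ e ↑ˡ m)
    (trans (cong₂ _∧_ (lookup-embed-↑ˡ S (end₁ e)) (RAdj-↑ˡ-↑ʳ (end₁ e) e))
           (cong₂ _∧_ end₁∈S (cong (_∨ ⌊ end₁ e ≟ end₂ e ⌋) (⌊≟-refl⌋ (end₁ e)))))
  ... | false | end₂∈S = anyFin⁺ _ (end₂ e ↑ˡ m)
    (trans (cong₂ _∧_ (lookup-embed-↑ˡ S (end₂ e)) (RAdj-↑ˡ-↑ʳ (end₂ e) e))
           (cong₂ _∧_ end₂∈S (trans (cong (⌊ end₂ e ≟ end₁ e ⌋ ∨_) (⌊≟-refl⌋ (end₂ e))) (∨-zeroʳ _))))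

  count-inBoundary-embed : ∀ S → IsVertexCover G S →
                           count (inBoundary G S) + m ≤ count (inBoundary (R G) (embed G S))
  count-inBoundary-embed S cover = begin
    count (inBoundary G S) + m                                   ≡⟨ cong₂ _+_ (count≡sum (inBoundary G S)) (sym (sum-ones m)) ⟩
    sum (𝟙 ∘ inBoundary G S) + sum {m} (λ _ → 1)                 ≤⟨ +-mono-≤ (sum-mono-≤ old-vertices) (sum-mono-≤ {m} new-vertices) ⟩
    sum (𝟙 ∘ B ∘ (_↑ˡ m)) + sum (𝟙 ∘ B ∘ (n ↑ʳ_))                ≡⟨ sum-splitAt n m (𝟙 ∘ B) ⟨
    sum (𝟙 ∘ B)                                                  ≡⟨ count≡sum B ⟨
    count B                                                      ∎
    where
    open ≤-Reasoning
    B = inBoundary (R G) (embed G S)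
    old-vertices : ∀ x → 𝟙 (inBoundary G S x) ≤ 𝟙 (B (x ↑ˡ m))
    old-vertices x = 𝟙-mono (inBoundary-embed S x)
    new-vertices : ∀ e → 1 ≤ 𝟙 (B (n ↑ʳ e))
    new-vertices e = ≤-reflexive (cong 𝟙 (sym (vertexCover⇒inBoundary-↑ʳ S cover e)))

  ∂ₛ-embed-vertexCover : ∀ S → IsVertexCover G S → ∂ₛ G S ℤ.+ + m ℤ.≤ ∂ₛ (R G) (embed G S)
  ∂ₛ-embed-vertexCover S cover = subst (ℤ._≤ ∂ₛ (R G) (embed G S)) (sym (m-n+k≡m+k-n b s m)) (m-n≤o-p (b + m) s b′ s′ counts)
    where
    b  = count (inBoundary G S)
    b′ = count (inBoundary (R G) (embed G S))
    s  = card S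
    s′ = card (embed G S)
    counts : b + m + s′ ≤ b′ + s
    counts rewrite card-embed S = +-monoˡ-≤ s (count-inBoundary-embed S cover)

  restrict : VSet (n + m) → VSet n
  restrict T = tabulate (λ x → lookup T (x ↑ˡ m))

  module _ (T : VSet (n + m)) where
    private
      Chosen : Fin m → Bool
      Chosen e = lookup T (n ↑ʳ e)
      B  = inBoundary (R G) T
      B₁ = inBoundary G (restrict T)

    𝟙-inBoundary-↑ˡ≤ : ∀ x → 𝟙 (B (x ↑ˡ m)) ≤ 𝟙 (B₁ x) + sum (λ e → 𝟙 (Chosen e) * incidence x e)
    𝟙-inBoundary-↑ˡ≤ x with B (x ↑ˡ m) in x∈B
    ... | false = z≤n
    ... | true with ∧-true⁻ {not (lookup T (x ↑ˡ m))} x∈B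
    ... | x∉T , ∃neighbour with anyFin⁻ _ ∃neighbour
    ... | u , u∈T∧adj with ↑ˡ⊎↑ʳ u
    ... | inj₁ (y , refl) = ≤-trans (≤-reflexive (cong 𝟙 (sym x∈B₁))) (m≤m+n _ _)
      where
      x∈B₁ : B₁ x ≡ true
      x∈B₁ = cong₂ _∧_ (trans (cong not (lookup∘tabulate _ x)) x∉T)
        (anyFin⁺ _ y (trans (cong₂ _∧_ (lookup∘tabulate _ y) (sym (RAdj-↑ˡ-↑ˡ y x))) u∈T∧adj))
    ... | inj₂ (e , refl) = ≤-trans 1≤chosen-incidences (m≤n+m _ (𝟙 (B₁ x)))
      where
      e∈T∧x-endOf-e = ∧-true⁻ {Chosen e} u∈T∧adj
      1≤incidence : 1 ≤ 𝟙 (Chosen e) * incidence x e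
      1≤incidence rewrite proj₁ e∈T∧x-endOf-e | ℕ.+-identityʳ (incidence x e) =
        IsEndOf⇒1≤incidence x e (trans (sym (RAdj-↑ʳ-↑ˡ e x)) (proj₂ e∈T∧x-endOf-e))
      1≤chosen-incidences : 1 ≤ sum (λ e → 𝟙 (Chosen e) * incidence x e)
      1≤chosen-incidences = ≤-trans 1≤incidence (term≤sum (λ e → 𝟙 (Chosen e) * incidence x e) e)

    𝟙-inBoundary-↑ʳ+𝟙-Chosen≤1 : ∀ e → 𝟙 (B (n ↑ʳ e)) + 𝟙 (Chosen e) ≤ 1
    𝟙-inBoundary-↑ʳ+𝟙-Chosen≤1 e with Chosen e
    ... | true  = s≤s z≤n
    ... | false = ≤-trans (≤-reflexive (ℕ.+-identityʳ _)) (𝟙≤1 _)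

    private
      q = sum (𝟙 ∘ Chosen)

    sum-𝟙-inBoundary-↑ˡ≤ : sum (𝟙 ∘ B ∘ (_↑ˡ m)) ≤ count B₁ + q * 2
    sum-𝟙-inBoundary-↑ˡ≤ = begin
      sum (𝟙 ∘ B ∘ (_↑ˡ m))                                        ≤⟨ sum-mono-≤ 𝟙-inBoundary-↑ˡ≤ ⟩
      sum (λ x → 𝟙 (B₁ x) + sum (λ e → 𝟙 (Chosen e) * incidence x e)) ≡⟨ ∑-distrib-+ {n} _ _ ⟩
      sum (𝟙 ∘ B₁) + sum (λ x → sum (λ e → 𝟙 (Chosen e) * incidence x e))
                                                                   ≡⟨ cong₂ _+_ (count≡sum B₁) (∑-comm {m} {n} _) ⟨
      count B₁ + sum (λ e → sum (λ x → 𝟙 (Chosen e) * incidence x e))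
                                                                   ≡⟨ cong (λ k → count B₁ + k) (sum-cong-≗ {m} chosen-edge-incidences) ⟩
      count B₁ + sum (λ e → 𝟙 (Chosen e) * 2)                      ≡⟨ cong (λ k → count B₁ + k) (*-distribʳ-sum 2 (𝟙 ∘ Chosen)) ⟨
      count B₁ + q * 2                                             ∎
      where
      open ≤-Reasoning
      chosen-edge-incidences : ∀ e → sum (λ x → 𝟙 (Chosen e) * incidence x e) ≡ 𝟙 (Chosen e) * 2
      chosen-edge-incidences e = trans (sym (*-distribˡ-sum (𝟙 (Chosen e)) (λ x → incidence x e)))
                                       (cong (𝟙 (Chosen e) *_) (sum-incidence e))

    sum-𝟙-inBoundary-↑ʳ+q≤m : sum (𝟙 ∘ B ∘ (n ↑ʳ_)) + q ≤ m
    sum-𝟙-inBoundary-↑ʳ+q≤m = begin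
      sum (𝟙 ∘ B ∘ (n ↑ʳ_)) + q                         ≡⟨ ∑-distrib-+ {m} _ _ ⟨
      sum (λ e → 𝟙 (B (n ↑ʳ e)) + 𝟙 (Chosen e))         ≤⟨ sum-mono-≤ 𝟙-inBoundary-↑ʳ+𝟙-Chosen≤1 ⟩
      sum {m} (λ _ → 1)                                 ≡⟨ sum-ones m ⟩
      m                                                 ∎
      where open ≤-Reasoning

    ∂ₛ-R≤∂ₛ-restrict+m : ∂ₛ (R G) T ℤ.≤ ∂ₛ G (restrict T) ℤ.+ + m
    ∂ₛ-R≤∂ₛ-restrict+m = subst (∂ₛ (R G) T ℤ.≤_) (sym (m-n+k≡m+k-n (count B₁) p m))
      (m-n≤o-p (count B) (card T) (count B₁ + m) p counts)
      where
      p = card (restrict T)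
      a = sum (𝟙 ∘ B ∘ (_↑ˡ m))
      b = sum (𝟙 ∘ B ∘ (n ↑ʳ_))
      count-B : count B ≡ a + b
      count-B = trans (count≡sum B) (sum-splitAt n m _)
      card-T : card T ≡ p + q
      card-T = begin
        card T                                           ≡⟨ count≡sum (lookup T) ⟩
        sum (𝟙 ∘ lookup T)                               ≡⟨ sum-splitAt n m _ ⟩
        sum (𝟙 ∘ lookup T ∘ (_↑ˡ m)) + q                 ≡⟨ cong (λ k → k + q) (sum-cong-≗ {n} (cong 𝟙 ∘ sym ∘ lookup∘tabulate _)) ⟩
        sum (𝟙 ∘ lookup (restrict T)) + q                ≡⟨ cong (λ k → k + q) (count≡sum (lookup (restrict T))) ⟨
        p + q                                            ∎
        where open ≡-Reasoning
      -- b ≤ m − q is only available as b + q ≤ m, hence q is added to both sides.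
      counts : count B + p ≤ count B₁ + m + card T
      counts rewrite count-B | card-T = ℕ.+-cancelʳ-≤ q _ _ (begin
        a + b + p + q              ≡⟨ regroupˡ a b p q ⟩
        a + (b + q) + p            ≤⟨ +-monoˡ-≤ p (+-mono-≤ sum-𝟙-inBoundary-↑ˡ≤ sum-𝟙-inBoundary-↑ʳ+q≤m) ⟩
        count B₁ + q * 2 + m + p   ≡⟨ regroupʳ (count B₁) q m p ⟩
        count B₁ + m + (p + q) + q ∎)
        where
        open ≤-Reasoning
        regroupˡ : ∀ a b p q → a + b + p + q ≡ a + (b + q) + p
        regroupˡ = ℕ-Solver.solve-∀
        regroupʳ : ∀ c q m p → c + q * 2 + m + p ≡ c + m + (p + q) + q
        regroupʳ = ℕ-Solver.solve-∀

∂G-R≤∂G+|E| : ∀ G → ∂G (R G) ℤ.≤ ∂G G ℤ.+ + length (edgeList G)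
∂G-R≤∂G+|E| G = ∂G-lub (R G) λ T →
  ℤ.≤-trans (∂ₛ-R≤∂ₛ-restrict+m G T) (ℤ.+-monoˡ-≤ (+ length (edgeList G)) (∂ₛ≤∂G G (restrict G T)))

proposition2p13 : (G : Graph) → Connected G → order G ≥ 3 →
                  (S : VSet (order G)) →
                  IsVertexCover G S → ∂ₛ G S ≡ ∂G G →
                  IsDifferentialSet (R G) (embed G S)
proposition2p13 G _ _ S cover S-differential = ℤ.≤-antisym (∂ₛ≤∂G (R G) (embed G S)) (begin
  ∂G (R G)                         ≤⟨ ∂G-R≤∂G+|E| G ⟩
  ∂G G ℤ.+ + length (edgeList G)   ≡⟨ cong (ℤ._+ + length (edgeList G)) S-differential ⟨
  ∂ₛ G S ℤ.+ + length (edgeList G) ≤⟨ ∂ₛ-embed-vertexCover G S cover ⟩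
  ∂ₛ (R G) (embed G S)             ∎)
  where open ℤ.≤-Reasoning
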